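{- Let $n\ge 4$. The wheel $W_n$ is an $\mathcal{N}$ position of Grim if and only if the path $P_{n-2}$ is an $\mathcal{N}$ position of Grim.
   Context: Grim: two players alternate moves on a finite simple undirected graph. Before play, isolated vertices are deleted. A move consists of choosing a remaining vertex and deleting it together with its incident edges, and then deleting every vertex that has become isolated. The player making the last move wins (a player with no available move loses). A graph is an $\mathcal{N}$ position if the player about to move has a winning strategy, and a $\mathcal{P}$ position otherwise. The wheel $W_n$ on $n$ vertices is the join $C_{n-1}+K_1$: a cycle on $n-1$ vertices together with a center vertex adjacent to all of them. $P_m$ is the path on $m$ vertices. -}

module Defs where

open import Data.Nat using (ℕ; zero; suc; _∸_; _≡ᵇ_)
open import Data.Fin using (Fin; zero; suc; toℕ; _≟_)
open import Data.Bool using (Bool; true; false; _∧_; _∨_; not; T)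
open import Data.List using (allFin)
open import Data.Bool.ListAction using (any)
open import Data.Product using (Σ; _×_)
open import Relation.Nullary.Decidable using (⌊_⌋)

-- A finite simple graph on vertex set Fin n, given by a Boolean adjacency
-- relation.  `simple` symmetrises a relation and removes loops, so every
-- graph built with it is a simple undirected graph.
Rel : ℕ → Set
Rel n = Fin n → Fin n → Bool

simple : ∀ {n} → Rel n → Rel n
simple R i j = not ⌊ i ≟ j ⌋ ∧ (R i j ∨ R j i)

-- Positions of Grim on a graph with adjacency `adj`: the set of remaining
-- vertices (the graph is the induced subgraph on it).
VSet : ℕ → Set
VSet n = Fin n → Bool

clean : ∀ {n} → Rel n → VSet n → VSet n
clean {n} adj S u = S u ∧ any (λ w → S w ∧ adj u w) (allFin n)

initial : ∀ {n} → Rel n → VSet n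
initial adj = clean adj (λ _ → true)

move : ∀ {n} → Rel n → VSet n → Fin n → VSet n
move adj S v = clean adj (λ u → S u ∧ not ⌊ u ≟ v ⌋)

-- Win adj S : the player to move from S has a winning strategy
-- Lose adj S : every move from S leads to a position won by the opponent
-- (in particular a position with no moves is a Lose position).
mutual
  data Win {n} (adj : Rel n) (S : VSet n) : Set where
    win : (v : Fin n) → T (S v) → Lose adj (move adj S v) → Win adj S

  data Lose {n} (adj : Rel n) (S : VSet n) : Set where
    lose : ((v : Fin n) → T (S v) → Win adj (move adj S v)) → Lose adj S

IsN : ∀ {n} → Rel n → Set
IsN adj = Win adj (initial adj)

-- Wheel W_n on vertex set Fin n: vertex 0 is the centre, vertices
-- 1, ..., n-1 form the cycle C_{n-1} (cycle index k = vertex suc k,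
-- k = 0..n-2, edges k~k+1 and 0~(n-2)).
wheelR : ∀ n → Rel n
wheelR (suc m) zero (suc j) = true
wheelR (suc m) (suc i) (suc j) =
  (toℕ j ≡ᵇ suc (toℕ i)) ∨ ((toℕ i ≡ᵇ 0) ∧ (toℕ j ≡ᵇ m ∸ 1))
wheelR _ _ _ = false

wheel : ∀ n → Rel n
wheel n = simple (wheelR n)

pathR : ∀ m → Rel m
pathR m i j = toℕ j ≡ᵇ suc (toℕ i)

path : ∀ m → Rel m
path m = simple (pathR m)

module Submission where

-- Deleting the centre of the wheel leaves a cycle, each move of which leaves the
-- path P_{n-2}; deleting a rim vertex leaves a fan, from which deleting the centre
-- again leaves P_{n-2}.  So if P_{n-2} is an N position the first player wins by
-- deleting the centre, and otherwise every first move lets the opponent move to the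
-- P position P_{n-2}.  Formally, all positions "wheel minus the centre and one rim
-- vertex" are identified with P_{n-2} by rotations of the rim, and the outcome of
-- Grim is invariant under graph embeddings that cover the remaining vertices.

open import Defs
open import Data.Nat as ℕ using (ℕ; zero; suc; _≡ᵇ_; _≤_; _∸_; NonZero; z≤n; s≤s)
import Data.Nat.Properties as ℕ
open import Data.Fin using (Fin; zero; suc; toℕ; _≟_; fromℕ; inject₁; lower₁)
open import Data.Fin.Properties
  using (toℕ-injective; suc-injective; toℕ<n; toℕ-fromℕ; toℕ-inject₁; toℕ-inject₁-≢; toℕ-lower₁;
         lower₁-inject₁′; inject₁-lower₁; inject₁-injective; fromℕ≢inject₁)
open import Data.Fin.Induction using (<-weakInduction)
open import Data.Bool using (true; false; _∧_; _∨_; not; T; T?)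
open import Data.Bool.Properties using (T-≡; T-∧; T-∨; ∧-zeroʳ; ∧-identityʳ)
open import Data.List using (allFin)
open import Data.List.Membership.Propositional using () renaming (lose to ∈-any)
open import Data.List.Membership.Propositional.Properties using (∈-allFin)
open import Data.List.Relation.Unary.Any using (satisfied)
open import Data.List.Relation.Unary.Any.Properties using (any⁺; any⁻)
open import Data.Product using (∃; _×_; _,_; proj₁; proj₂) renaming (map₂ to ×-map₂)
open import Data.Sum using (_⊎_; inj₁; inj₂; [_,_]′; swap) renaming (map to ⊎-map)
open import Data.Empty using (⊥-elim)
open import Relation.Nullary using (yes; no)
open import Function using (_∘_; _⇔_; mk⇔; Equivalence)
open import Function.Definitions using (Injective)
import Function.Properties.Equivalence as ⇔
open import Relation.Nullary.Decidable using (⌊_⌋; True; does-⇔; fromWitness; toWitness; fromWitnessFalse; toWitnessFalse)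
open import Relation.Binary.PropositionalEquality
open ≡-Reasoning

open Equivalence using (to; from)

private variable
  a b : ℕ

T-ext : ∀ {x y} → (T x → T y) → (T y → T x) → x ≡ y
T-ext x⇒y y⇒x = does-⇔ (mk⇔ x⇒y y⇒x) (T? _) (T? _)

⌊≟⌋-injective : {f : Fin a → Fin b} → Injective _≡_ _≡_ f → ∀ x y → ⌊ f x ≟ f y ⌋ ≡ ⌊ x ≟ y ⌋
⌊≟⌋-injective {f = f} f-inj x y =
  T-ext (fromWitness ∘ f-inj ∘ toWitness) (fromWitness ∘ cong f ∘ toWitness)

clean-intro : (A : Rel a) (S : VSet a) (u w : Fin a) →
              T (S u) → T (S w) → T (A u w) → T (clean A S u)
clean-intro A S u w Su Sw Auw =
  from T-∧ (Su , any⁺ _ (∈-any (∈-allFin w) (from T-∧ (Sw , Auw))))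

clean-elim : (A : Rel a) (S : VSet a) {u : Fin a} →
             T (clean A S u) → T (S u) × ∃ λ w → T (S w) × T (A u w)
clean-elim {a} A S t with to T-∧ t
... | Su , t′ with satisfied (any⁻ _ (allFin a) t′)
... | w , SwAuw = Su , w , to T-∧ SwAuw

move-intro : (A : Rel a) (S : VSet a) (v u w : Fin a) →
             T (S u) → u ≢ v → T (S w) → w ≢ v → T (A u w) → T (move A S v u)
move-intro A S v u w Su u≢v Sw w≢v =
  clean-intro A (λ x → S x ∧ not ⌊ x ≟ v ⌋) u w (from T-∧ (Su , fromWitnessFalse u≢v))
    (from T-∧ (Sw , fromWitnessFalse w≢v))

move-elim : (A : Rel a) (S : VSet a) (v : Fin a) {u : Fin a} → T (move A S v u) → T (S u) × u ≢ v
move-elim A S v t = ×-map₂ toWitnessFalse (to T-∧ (proj₁ (clean-elim A _ t)))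

record Embedding (A : Rel a) (B : Rel b) : Set where
  field
    embed     : Fin a → Fin b
    injective : Injective _≡_ _≡_ embed
    adjacency : ∀ i j → B (embed i) (embed j) ≡ A i j

module _ {A : Rel a} {B : Rel b} (e : Embedding A B) where
  open Embedding e

  -- S′ is the image of S, so play from S′ never leaves the embedded copy of A.
  record Corresponds (S : VSet a) (S′ : VSet b) : Set where
    field
      restrict : ∀ i → S′ (embed i) ≡ S i
      covered  : ∀ v → T (S′ v) → ∃ λ i → embed i ≡ v
  open Corresponds

  clean-corresponds : ∀ {S S′} → Corresponds S S′ → Corresponds (clean A S) (clean B S′)
  clean-corresponds {S} {S′} c = record
    { restrict = λ i → T-ext (reflect i) (preserve i)
    ; covered  = λ v → covered c v ∘ proj₁ ∘ clean-elim B S′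
    }
    where
    preserve : ∀ i → T (clean A S i) → T (clean B S′ (embed i))
    preserve i t with clean-elim A S t
    ... | Si , j , Sj , Aij =
      clean-intro B S′ (embed i) (embed j) (subst T (sym (restrict c i)) Si)
        (subst T (sym (restrict c j)) Sj) (subst T (sym (adjacency i j)) Aij)
    reflect : ∀ i → T (clean B S′ (embed i)) → T (clean A S i)
    reflect i t with clean-elim B S′ t
    ... | S′i , w , S′w , Biw with covered c w S′w
    ...   | j , refl = clean-intro A S i j (subst T (restrict c i) S′i)
                         (subst T (restrict c j) S′w) (subst T (adjacency i j) Biw)

  move-corresponds : ∀ {S S′} → Corresponds S S′ → ∀ i → Corresponds (move A S i) (move B S′ (embed i))
  move-corresponds c i = clean-corresponds record
    { restrict = λ j → cong₂ _∧_ (restrict c j) (cong not (⌊≟⌋-injective injective j i))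
    ; covered  = λ v → covered c v ∘ proj₁ ∘ to T-∧
    }

  mutual
    Win-embed : ∀ {S S′} → Corresponds S S′ → Win A S → Win B S′
    Win-embed c (win i Si l) =
      win (embed i) (subst T (sym (restrict c i)) Si) (Lose-embed (move-corresponds c i) l)

    Lose-embed : ∀ {S S′} → Corresponds S S′ → Lose A S → Lose B S′
    Lose-embed {S′ = S′} c (lose h) = lose answer
      where
      answer : ∀ v → T (S′ v) → Win B (move B S′ v)
      answer v S′v with covered c v S′v
      ... | i , refl = Win-embed (move-corresponds c i) (h i (subst T (restrict c i) S′v))

    Win-restrict : ∀ {S S′} → Corresponds S S′ → Win B S′ → Win A S
    Win-restrict c (win v S′v l) with covered c v S′v
    ... | i , refl = win i (subst T (restrict c i) S′v) (Lose-restrict (move-corresponds c i) l)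

    Lose-restrict : ∀ {S S′} → Corresponds S S′ → Lose B S′ → Lose A S
    Lose-restrict c (lose h) =
      lose λ i Si → Win-restrict (move-corresponds c i) (h (embed i) (subst T (sym (restrict c i)) Si))

  Win-corresponds : ∀ {S S′} → Corresponds S S′ → Win A S ⇔ Win B S′
  Win-corresponds c = mk⇔ (Win-embed c) (Win-restrict c)

  Win-clean-corresponds : ∀ {S S′} → Corresponds S S′ → Win A (clean A S) ⇔ Win B (clean B S′)
  Win-clean-corresponds = Win-corresponds ∘ clean-corresponds

id-embedding : (A : Rel a) → Embedding A A
id-embedding A = record { embed = λ i → i ; injective = λ e → e ; adjacency = λ _ _ → refl }

Win-move-≗ : (A : Rel a) (S : VSet a) (v : Fin a) (S′ : VSet a) →
             (∀ u → S u ∧ not ⌊ u ≟ v ⌋ ≡ S′ u) → Win A (move A S v) ⇔ Win A (clean A S′)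
Win-move-≗ A S v S′ S-v≗S′ = Win-clean-corresponds (id-embedding A) record
  { restrict = λ u → sym (S-v≗S′ u) ; covered = λ u _ → u , refl }

rot : ∀ {m} → Fin (suc m) → Fin (suc m)
rot {m} a with toℕ a ℕ.≟ m
... | yes _   = zero
... | no a≢m = suc (lower₁ a (a≢m ∘ sym))

toℕ-rot : ∀ {m} (a : Fin (suc m)) →
          (toℕ a ≡ m × rot a ≡ zero) ⊎ (toℕ a ≢ m × toℕ (rot a) ≡ suc (toℕ a))
toℕ-rot {m} a with toℕ a ℕ.≟ m
... | yes a≡m = inj₁ (a≡m , refl)
... | no a≢m = inj₂ (a≢m , cong suc (toℕ-lower₁ a _))

rot-fromℕ : ∀ m → rot (fromℕ m) ≡ zero
rot-fromℕ m with toℕ (fromℕ m) ℕ.≟ m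
... | yes _   = refl
... | no last≢m = ⊥-elim (last≢m (toℕ-fromℕ m))

rot-inject₁ : ∀ {m} (i : Fin m) → rot (inject₁ i) ≡ suc i
rot-inject₁ {m} i with toℕ (inject₁ i) ℕ.≟ m
... | yes i≡m = ⊥-elim (toℕ-inject₁-≢ i (sym i≡m))
... | no _    = cong suc (lower₁-inject₁′ i _)

rot-surjective : ∀ {m} (v : Fin (suc m)) → ∃ λ a → rot a ≡ v
rot-surjective {m}     zero    = fromℕ m , rot-fromℕ m
rot-surjective {suc m} (suc i) = inject₁ i , rot-inject₁ i

rot-injective : ∀ {m} → Injective _≡_ _≡_ (rot {m})
rot-injective {x = a} {b} ra≡rb with toℕ-rot a | toℕ-rot b
... | inj₁ (a≡m , _)  | inj₁ (b≡m , _)  = toℕ-injective (trans a≡m (sym b≡m))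
... | inj₁ (_ , ra≡0) | inj₂ (_ , rb≡1+) with () ← trans (sym (cong toℕ (trans (sym ra≡rb) ra≡0))) rb≡1+
... | inj₂ (_ , ra≡1+) | inj₁ (_ , rb≡0) with () ← trans (sym (cong toℕ (trans ra≡rb rb≡0))) ra≡1+
... | inj₂ (_ , ra≡1+) | inj₂ (_ , rb≡1+) =
  toℕ-injective (ℕ.suc-injective (trans (sym ra≡1+) (trans (cong toℕ ra≡rb) rb≡1+)))

rot-≢ : ∀ {m} .{{_ : NonZero m}} (a : Fin (suc m)) → rot a ≢ a
rot-≢ {m} a ra≡a with toℕ-rot a
... | inj₁ (a≡m , ra≡0) = ℕ.≢-nonZero⁻¹ m (trans (sym a≡m) (cong toℕ (trans (sym ra≡a) ra≡0)))
... | inj₂ (_ , ra≡1+) = ℕ.1+n≢n (trans (sym ra≡1+) (cong toℕ ra≡a))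

-- The rim clause of `wheelR`.
rimR : ∀ m → Rel (suc m)
rimR m a b = (toℕ b ≡ᵇ suc (toℕ a)) ∨ ((toℕ a ≡ᵇ 0) ∧ (toℕ b ≡ᵇ m))

rimR⇒rot : ∀ {m} (a b : Fin (suc m)) → T (rimR m a b) → b ≡ rot a ⊎ a ≡ rot b
rimR⇒rot {m} a b t with to T-∨ t
... | inj₁ b≡1+a with toℕ-rot a
...   | inj₁ (a≡m , _)   = ⊥-elim (ℕ.<⇒≢ (toℕ<n b) (trans (ℕ.≡ᵇ⇒≡ _ _ b≡1+a) (cong suc a≡m)))
...   | inj₂ (_ , ra≡1+) = inj₁ (toℕ-injective (trans (ℕ.≡ᵇ⇒≡ _ _ b≡1+a) (sym ra≡1+)))
rimR⇒rot {m} a b t | inj₂ a≡0∧b≡m with to T-∧ a≡0∧b≡m | toℕ-rot b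
... | a≡0 , _ | inj₁ (_ , rb≡0)    = inj₂ (trans (toℕ-injective (ℕ.≡ᵇ⇒≡ _ 0 a≡0)) (sym rb≡0))
... | _ , b≡m | inj₂ (b≢m , _)     = ⊥-elim (b≢m (ℕ.≡ᵇ⇒≡ _ m b≡m))

rimR-step : ∀ {m} {a b : Fin (suc m)} → toℕ b ≡ suc (toℕ a) → T (rimR m a b)
rimR-step {a = a} {b} b≡1+a = from (T-∨ {toℕ b ≡ᵇ suc (toℕ a)}) (inj₁ (ℕ.≡⇒≡ᵇ _ _ b≡1+a))

rimR-wrap : ∀ {m} {a b : Fin (suc m)} → toℕ a ≡ 0 → toℕ b ≡ m → T (rimR m a b)
rimR-wrap {m} {a} {b} a≡0 b≡m =
  from (T-∨ {toℕ b ≡ᵇ suc (toℕ a)}) (inj₂ (from T-∧ (ℕ.≡⇒≡ᵇ _ 0 a≡0 , ℕ.≡⇒≡ᵇ _ m b≡m)))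

rot⇒rimR : ∀ {m} (a : Fin (suc m)) → T (rimR m a (rot a)) ⊎ T (rimR m (rot a) a)
rot⇒rimR a with toℕ-rot a
... | inj₁ (a≡m , ra≡0) = inj₂ (rimR-wrap (cong toℕ ra≡0) a≡m)
... | inj₂ (_ , ra≡1+) = inj₁ (rimR-step ra≡1+)

rimR-closure-rot : ∀ {m} (a b : Fin (suc m)) → rimR m a b ∨ rimR m b a ≡ ⌊ b ≟ rot a ⌋ ∨ ⌊ a ≟ rot b ⌋
rimR-closure-rot {m} a b = T-ext forward backward
  where
  forward : T (rimR m a b ∨ rimR m b a) → T (⌊ b ≟ rot a ⌋ ∨ ⌊ a ≟ rot b ⌋)
  forward t = from (T-∨ {⌊ b ≟ rot a ⌋}) (⊎-map fromWitness fromWitness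
                          ([ rimR⇒rot a b , swap ∘ rimR⇒rot b a ]′ (to T-∨ t)))
  rot-adjacent : ∀ x y → True (y ≟ rot x) → T (rimR m x y) ⊎ T (rimR m y x)
  rot-adjacent x y t with toWitness t
  ... | refl = rot⇒rimR x
  backward : T (⌊ b ≟ rot a ⌋ ∨ ⌊ a ≟ rot b ⌋) → T (rimR m a b ∨ rimR m b a)
  backward t = from T-∨ ([ rot-adjacent a b , swap ∘ rot-adjacent b a ]′ (to T-∨ t))

wheel-rim : ∀ {m} (a b : Fin (suc m)) →
            wheel (suc (suc m)) (suc a) (suc b) ≡ not ⌊ a ≟ b ⌋ ∧ (⌊ b ≟ rot a ⌋ ∨ ⌊ a ≟ rot b ⌋)
wheel-rim a b = cong₂ (λ x y → not x ∧ y) (⌊≟⌋-injective suc-injective a b) (rimR-closure-rot a b)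

rotate : ∀ {m} → Fin (suc (suc m)) → Fin (suc (suc m))
rotate zero    = zero
rotate (suc a) = suc (rot a)

rotate-injective : ∀ {m} → Injective _≡_ _≡_ (rotate {m})
rotate-injective {x = zero}  {zero}  _  = refl
rotate-injective {x = suc a} {suc b} ra≡rb = cong suc (rot-injective (suc-injective ra≡rb))

rotation : ∀ m → Embedding (wheel (suc (suc m))) (wheel (suc (suc m)))
rotation m = record { embed = rotate ; injective = rotate-injective ; adjacency = rotate-adjacency }
  where
  rotate-adjacency : ∀ x y → wheel (suc (suc m)) (rotate x) (rotate y) ≡ wheel (suc (suc m)) x y
  rotate-adjacency zero    zero    = refl
  rotate-adjacency zero    (suc b) = refl
  rotate-adjacency (suc a) zero    = refl
  rotate-adjacency (suc a) (suc b) = begin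
    wheel _ (suc (rot a)) (suc (rot b))
      ≡⟨ wheel-rim (rot a) (rot b) ⟩
    not ⌊ rot a ≟ rot b ⌋ ∧ (⌊ rot b ≟ rot (rot a) ⌋ ∨ ⌊ rot a ≟ rot (rot b) ⌋)
      ≡⟨ cong₂ (λ x y → not x ∧ y) (⌊rot≟rot⌋ a b) (cong₂ _∨_ (⌊rot≟rot⌋ b (rot a)) (⌊rot≟rot⌋ a (rot b))) ⟩
    not ⌊ a ≟ b ⌋ ∧ (⌊ b ≟ rot a ⌋ ∨ ⌊ a ≟ rot b ⌋)
      ≡⟨ wheel-rim a b ⟨
    wheel _ (suc a) (suc b) ∎
    where
    ⌊rot≟rot⌋ : ∀ x y → ⌊ rot x ≟ rot y ⌋ ≡ ⌊ x ≟ y ⌋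
    ⌊rot≟rot⌋ = ⌊≟⌋-injective rot-injective

⌊inject₁≟rot-inject₁⌋ : ∀ {m} (i j : Fin m) → ⌊ inject₁ j ≟ rot (inject₁ i) ⌋ ≡ (toℕ j ≡ᵇ suc (toℕ i))
⌊inject₁≟rot-inject₁⌋ i j rewrite rot-inject₁ i =
  T-ext (λ t → ℕ.≡⇒≡ᵇ _ _ (trans (sym (toℕ-inject₁ j)) (cong toℕ (toWitness t))))
        (λ t → fromWitness (toℕ-injective (trans (toℕ-inject₁ j) (ℕ.≡ᵇ⇒≡ _ _ t))))

path-in-rim : ∀ m → Embedding (path m) (wheel (suc (suc m)))
path-in-rim m = record
  { embed     = suc ∘ inject₁
  ; injective = inject₁-injective ∘ suc-injective
  ; adjacency = λ i j → begin
      wheel _ (suc (inject₁ i)) (suc (inject₁ j))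
        ≡⟨ wheel-rim (inject₁ i) (inject₁ j) ⟩
      not ⌊ inject₁ i ≟ inject₁ j ⌋ ∧ (⌊ inject₁ j ≟ rot (inject₁ i) ⌋ ∨ ⌊ inject₁ i ≟ rot (inject₁ j) ⌋)
        ≡⟨ cong₂ (λ x y → not x ∧ y) (⌊≟⌋-injective inject₁-injective i j)
                 (cong₂ _∨_ (⌊inject₁≟rot-inject₁⌋ i j) (⌊inject₁≟rot-inject₁⌋ j i)) ⟩
      path m i j ∎
  }

rimWithout : ∀ {m} → Fin (suc m) → VSet (suc (suc m))
rimWithout j zero    = false
rimWithout j (suc a) = not ⌊ a ≟ j ⌋

rotate-rimWithout : ∀ {m} (j : Fin (suc m)) → Corresponds (rotation m) (rimWithout j) (rimWithout (rot j))
rotate-rimWithout j = record { restrict = restrict ; covered = covered }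
  where
  restrict : ∀ x → rimWithout (rot j) (rotate x) ≡ rimWithout j x
  restrict zero    = refl
  restrict (suc a) = cong not (⌊≟⌋-injective rot-injective a j)
  covered : ∀ v → T (rimWithout (rot j) v) → ∃ λ x → rotate x ≡ v
  covered (suc w) _ with rot-surjective w
  ... | a , refl = suc a , refl

path-rimWithout-last : ∀ m → Corresponds (path-in-rim m) (λ _ → true) (rimWithout (fromℕ m))
path-rimWithout-last m = record { restrict = restrict ; covered = covered }
  where
  restrict : ∀ i → not ⌊ inject₁ i ≟ fromℕ m ⌋ ≡ true
  restrict i = to T-≡ (fromWitnessFalse (fromℕ≢inject₁ ∘ sym))
  covered : ∀ v → T (rimWithout (fromℕ m) v) → ∃ λ i → suc (inject₁ i) ≡ v
  covered (suc a) a≢last = lower₁ a m≢a , cong suc (inject₁-lower₁ a m≢a)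
    where
    m≢a : m ≢ toℕ a
    m≢a m≡a = toWitnessFalse a≢last (toℕ-injective (trans (sym m≡a) (sym (toℕ-fromℕ m))))

rimWithout⇔path : ∀ {m} (j : Fin (suc m)) → Win (wheel (suc (suc m))) (clean _ (rimWithout j)) ⇔ IsN (path m)
rimWithout⇔path {m} = <-weakInduction P (subst P (rot-fromℕ m) (rotate-step last-case))
                                        (λ i → subst P (rot-inject₁ i) ∘ rotate-step)
  where
  P : Fin (suc m) → Set
  P j = Win (wheel (suc (suc m))) (clean _ (rimWithout j)) ⇔ IsN (path m)
  last-case : P (fromℕ m)
  last-case = ⇔.sym (Win-clean-corresponds (path-in-rim m) (path-rimWithout-last m))
  rotate-step : ∀ {j} → P j → P (rot j)
  rotate-step {j} = ⇔.trans (⇔.sym (Win-clean-corresponds (rotation m) (rotate-rimWithout j)))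

module _ (m : ℕ) .{{_ : NonZero m}} where
  private
    W : Rel (suc (suc m))
    W = wheel (suc (suc m))

  initial-wheel : ∀ u → T (initial W u)
  initial-wheel zero    = clean-intro W (λ _ → true) zero (suc zero) _ _ _
  initial-wheel (suc a) = clean-intro W (λ _ → true) (suc a) zero _ _ _

  rot-rim-adjacent : ∀ a → T (W (suc a) (suc (rot a)))
  rot-rim-adjacent a = subst T (sym (wheel-rim a (rot a)))
    (from (T-∧ {not ⌊ a ≟ rot a ⌋})
      (fromWitnessFalse (rot-≢ a ∘ sym) , from (T-∨ {⌊ rot a ≟ rot a ⌋}) (inj₁ (fromWitness refl))))

  cycle : VSet (suc (suc m))
  cycle = move W (initial W) zero

  cycle-centre : cycle zero ≡ false
  cycle-centre = T-ext (λ t → ⊥-elim (proj₂ (move-elim W (initial W) zero t) refl)) λ ()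

  cycle-rim : ∀ a → cycle (suc a) ≡ true
  cycle-rim a = to T-≡ (move-intro W (initial W) zero (suc a) (suc (rot a))
    (initial-wheel (suc a)) (λ ()) (initial-wheel (suc (rot a))) (λ ()) (rot-rim-adjacent a))

  cycle-move : ∀ j → Win W (move W cycle (suc j)) ⇔ Win W (clean W (rimWithout j))
  cycle-move j = Win-move-≗ W cycle (suc j) (rimWithout j) λ where
    zero    → cong (_∧ true) cycle-centre
    (suc a) → cong₂ (λ x y → x ∧ not y) (cycle-rim a) (⌊≟⌋-injective suc-injective a j)

  fan : Fin (suc m) → VSet (suc (suc m))
  fan j = move W (initial W) (suc j)

  fan-centre : ∀ j → T (fan j zero)
  fan-centre j = move-intro W (initial W) (suc j) zero (suc (rot j))
    (initial-wheel zero) (λ ()) (initial-wheel (suc (rot j))) (rot-≢ j ∘ suc-injective) _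

  fan-rim : ∀ j a → fan j (suc a) ≡ not ⌊ a ≟ j ⌋
  fan-rim j a = T-ext
    (λ t → fromWitnessFalse (proj₂ (move-elim W (initial W) (suc j) t) ∘ cong suc))
    (λ a≢j → move-intro W (initial W) (suc j) (suc a) zero
      (initial-wheel (suc a)) (toWitnessFalse a≢j ∘ suc-injective) (initial-wheel zero) (λ ()) _)

  fan-move : ∀ j → Win W (move W (fan j) zero) ⇔ Win W (clean W (rimWithout j))
  fan-move j = Win-move-≗ W (fan j) zero (rimWithout j) λ where
    zero    → ∧-zeroʳ (fan j zero)
    (suc a) → trans (∧-identityʳ _) (fan-rim j a)

  wheel-N⇔path-N : IsN W ⇔ IsN (path m)
  wheel-N⇔path-N = mk⇔ first-move reply
    where
    first-move : IsN W → IsN (path m)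
    first-move (win zero _ (lose cycle-won)) =
      to (rimWithout⇔path zero) (to (cycle-move zero) (cycle-won (suc zero) (from T-≡ (cycle-rim zero))))
    first-move (win (suc j) _ (lose fan-won)) =
      to (rimWithout⇔path j) (to (fan-move j) (fan-won zero (fan-centre j)))
    reply : IsN (path m) → IsN W
    reply path-won = win zero (initial-wheel zero) (lose λ where
      zero    centre → ⊥-elim (subst T cycle-centre centre)
      (suc j) _      → from (cycle-move j) (from (rimWithout⇔path j) path-won))

corollary5p7 : (n : ℕ) → 4 ≤ n →
    (IsN (wheel n) → IsN (path (n ∸ 2))) × (IsN (path (n ∸ 2)) → IsN (wheel n))
corollary5p7 (suc (suc m)) (s≤s (s≤s (s≤s (s≤s z≤n)))) = to (wheel-N⇔path-N m) , from (wheel-N⇔path-N m)
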